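{- Let a conjunctive Boolean control network (CBCN) be given in which no state-variable that is not directly controlled has a constant update function. The CBCN is controllable if and only if its dependency graph is a directed acyclic graph and the CBCN has Property P (every simple node of its dependency graph has, among its in-neighbors, either a generator or a channel).
   Context: A CBCN with $n$ Boolean state-variables and control index set $\mathcal{I}\subseteq\{1,\dots,n\}$ evolves by $X_i(k+1)=U_i(k)$ for $i\in\mathcal{I}$ and $X_i(k+1)=\prod_{j=1}^n (X_j(k))^{\epsilon_{ji}}$ for $i\notin\mathcal{I}$, where $\epsilon_{ji}\in\{0,1\}$, products denote AND, $x^0=1$, and the $U_i(k)$ are independent Boolean controls; a state-variable $i\notin\mathcal{I}$ has a constant update function if $\epsilon_{ji}=0$ for all $j$. It is controllable if for every $a,b\in\{0,1\}^n$ there exist $N\ge 0$ and controls steering $X(0)=a$ to $X(N)=b$. Its dependency graph is the digraph with a vertex for each state-variable (a simple node) and a vertex for each control input $U_i$, $i\in\mathcal{I}$ (a generator), with an arc $j\to i$ whenever $i\notin\mathcal{I}$ and $\epsilon_{ji}=1$, and an arc $U_i\to i$ for each $i\in\mathcal{I}$. A channel is a simple node with out-degree exactly one and without a self-loop. -}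

module Defs where

open import Data.Nat using (ℕ; zero; suc)
open import Data.Fin using (Fin)
open import Data.Bool using (Bool; true; false; if_then_else_; _∧_; _∨_; not)
open import Data.List using (map; allFin)
open import Data.Bool.ListAction using (and)
open import Data.Empty using (⊥)
open import Data.Unit using (⊤)
open import Data.Product using (Σ; ∃; _×_; _,_)
open import Data.Sum using (_⊎_)
open import Relation.Nullary using (¬_)
open import Relation.Binary.PropositionalEquality using (_≡_)
open import Relation.Binary.Construct.Closure.Transitive using (TransClosure)

-- A conjunctive Boolean control network with n state-variables.
--   ctrl i ≡ true  iff  i ∈ 𝓘 (i is directly controlled)
--   eps j i        is  ε_{ji}
record CBCN (n : ℕ) : Set where
  field
    ctrl : Fin n → Bool
    eps  : Fin n → Fin n → Bool
open CBCN public

State : ℕ → Set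
State n = Fin n → Bool

-- a control value at one time step (only the coordinates in 𝓘 are used)
Control : ℕ → Set
Control n = Fin n → Bool

-- X_i(k+1) = U_i(k) for i ∈ 𝓘, and ∏_j X_j(k)^{ε_ji} otherwise (x^0 = 1, x^1 = x)
step : ∀ {n} → CBCN n → State n → Control n → State n
step {n} C x u i =
  if ctrl C i then u i
  else and (map (λ j → not (eps C j i) ∨ x j) (allFin n))

run : ∀ {n} → CBCN n → State n → (ℕ → Control n) → ℕ → State n
run C a us zero    = a
run C a us (suc k) = step C (run C a us k) (us k)

Controllable : ∀ {n} → CBCN n → Set
Controllable {n} C =
  (a b : State n) → ∃ λ (N : ℕ) → ∃ λ (us : ℕ → Control n) →
    ∀ i → run C a us N i ≡ b i

NoConstantUpdate : ∀ {n} → CBCN n → Set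
NoConstantUpdate {n} C =
  ∀ (i : Fin n) → ctrl C i ≡ false → ∃ λ (j : Fin n) → eps C j i ≡ true

module _ {n : ℕ} (C : CBCN n) where

  data Vertex : Set where
    node : Fin n → Vertex
    gen  : (i : Fin n) → ctrl C i ≡ true → Vertex

  data Arc : Vertex → Vertex → Set where
    dep : ∀ {j i} → ctrl C i ≡ false → eps C j i ≡ true → Arc (node j) (node i)
    ctl : ∀ {i} (p : ctrl C i ≡ true) → Arc (gen i p) (node i)

  IsDAG : Set
  IsDAG = ∀ (v : Vertex) → ¬ TransClosure Arc v v

  Channel : Fin n → Set
  Channel j =
    (∃ λ (v : Vertex) → Arc (node j) v × (∀ w → Arc (node j) w → w ≡ v))
    × ¬ Arc (node j) (node j)

  IsGenerator : Vertex → Set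
  IsGenerator (node _)  = ⊥
  IsGenerator (gen _ _) = ⊤

  IsChannel : Vertex → Set
  IsChannel (node j)  = Channel j
  IsChannel (gen _ _) = ⊥

  PropertyP : Set
  PropertyP = ∀ (i : Fin n) → ∃ λ (v : Vertex) →
    Arc v (node i) × (IsGenerator v ⊎ IsChannel v)

module Submission where

-- Sufficiency combines two facts.
--  * Forgetting: in an acyclic graph the state at time n does not depend on the
--    initial state.  Two runs with the same controls that differ at node i at time m
--    yield a backward walk of length m ending in i (a difference at a conjunction
--    comes from a difference at an in-neighbour); a walk of length n visits some node
--    twice, giving a cycle.
--  * Backward reachability: under Property P every target b has a one-step preimage
--    (use b itself as the control and switch off exactly the channel parents of the
--    uncontrolled nodes that b switches off), so every b is the time-m state of some
--    run, for every m.
-- Necessity: a node on a cycle stays 0 forever when started from the all-zero state,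
-- so the all-one state is unreachable; and steering the all-one state to the state
-- that is 0 only at an uncontrolled node i exhibits an in-neighbour of i whose only
-- out-neighbour is i, i.e. a channel.

open import Defs
open import Data.Nat using (ℕ; zero; suc; _<_; _≤_; s≤s)
open import Data.Nat.Properties using (m≤n⇒m<n∨m≡n; <⇒≤; n<1+n)
open import Data.Fin using (Fin; toℕ; _≟_)
open import Data.Fin.Properties using (pigeonhole; any?; toℕ≤pred[n])
open import Data.Bool using (Bool; true; false; not; _∨_; if_then_else_)
open import Data.Bool.Properties using (if-cong; ¬-not) renaming (_≟_ to _≟ᵇ_)
open import Data.Bool.ListAction using (and)
open import Data.List using ([]; _∷_; map; allFin)
open import Data.List.Properties using (map-cong)
open import Data.List.Membership.Propositional using (_∈_)
open import Data.List.Membership.Propositional.Properties using (∈-allFin)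
open import Data.List.Relation.Unary.Any using (here; there)
open import Data.Empty using (⊥-elim)
open import Data.Unit using (tt)
open import Data.Product using (∃; _×_; _,_; proj₁)
open import Data.Sum using (_⊎_; inj₁; inj₂)
open import Function using (_∘_; id)
open import Function.Bundles using (_⇔_; mk⇔; Equivalence)
open import Relation.Nullary using (¬_; Dec; yes; no; does)
open import Relation.Nullary.Decidable using (_×-dec_; dec-true; dec-false)
open import Relation.Binary.PropositionalEquality
  using (_≡_; _≢_; _≗_; refl; sym; trans; cong; cong₂; subst; module ≡-Reasoning)
open import Relation.Binary.Construct.Closure.Transitive
  using (TransClosure; [_]; _∷_; equivalent)
import Relation.Binary.Construct.Closure.Transitive as TC

true≢false : true ≢ false
true≢false ()

and-map-false : ∀ {A : Set} (f : A → Bool) {x} xs → x ∈ xs → f x ≡ false →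
  and (map f xs) ≡ false
and-map-false f (y ∷ ys) (here refl) fx rewrite fx = refl
and-map-false f (y ∷ ys) (there x∈ys) fx with f y
... | true  = and-map-false f ys x∈ys fx
... | false = refl

and-map-true : ∀ {A : Set} (f : A → Bool) xs → (∀ x → f x ≡ true) →
  and (map f xs) ≡ true
and-map-true f []       _ = refl
and-map-true f (y ∷ ys) h rewrite h y = and-map-true f ys h

and-map-false⁻ : ∀ {A : Set} (f : A → Bool) xs → and (map f xs) ≡ false →
  ∃ λ x → f x ≡ false
and-map-false⁻ f (y ∷ ys) e with f y in fy
... | false = y , fy
... | true  = and-map-false⁻ f ys e

factor-false⁻ : ∀ ε x → not ε ∨ x ≡ false → ε ≡ true × x ≡ false
factor-false⁻ true false _ = refl , refl

_◂_ : ∀ {A : Set} → A → (ℕ → A) → ℕ → A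
(x ◂ xs) zero    = x
(x ◂ xs) (suc k) = xs k

unsnoc : ∀ {A : Set} {R : A → A → Set} {u w} → TransClosure R u w →
  R u w ⊎ ∃ λ v → TransClosure R u v × R v w
unsnoc [ r ] = inj₁ r
unsnoc (r ∷ t) with unsnoc t
... | inj₁ r′           = inj₂ (_ , [ r ] , r′)
... | inj₂ (v , t′ , r′) = inj₂ (v , r ∷ t′ , r′)

BackWalk : ∀ {A : Set} → (A → A → Set) → (ℕ → A) → ℕ → Set
BackWalk R f m = ∀ t → t < m → R (f (suc t)) (f t)

walk-segment : ∀ {A : Set} {R : A → A → Set} {f m} → BackWalk R f m →
  ∀ p q → p < q → q ≤ m → TransClosure R (f q) (f p)
walk-segment walk p (suc q) (s≤s p≤q) q<m with m≤n⇒m<n∨m≡n p≤q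
... | inj₁ p<q  = walk q q<m ∷ walk-segment walk p q p<q (<⇒≤ q<m)
... | inj₂ refl = [ walk q q<m ]

walk-cycle : ∀ {n} {R : Fin n → Fin n → Set} {f} → BackWalk R f n →
  ∃ λ v → TransClosure R v v
walk-cycle {n} {R} {f} walk with pigeonhole (n<1+n n) (f ∘ toℕ)
... | p , q , p<q , fp≡fq = f (toℕ p) ,
  subst (λ v → TransClosure R v (f (toℕ p))) (sym fp≡fq)
        (walk-segment walk (toℕ p) (toℕ q) p<q (toℕ≤pred[n] q))

module _ {n : ℕ} (C : CBCN n) where

  _⇾_ : Fin n → Fin n → Set
  j ⇾ i = Arc C (node j) (node i)

  node-injective : ∀ {i j} → node {C = C} i ≡ node j → i ≡ j
  node-injective refl = refl

  lift-path : ∀ {i j} → TransClosure _⇾_ i j → TransClosure (Arc C) (node i) (node j)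
  lift-path = Equivalence.to equivalent ∘ TC.map {f = node} id ∘ Equivalence.from equivalent

  channel-unique : ∀ {j i k} → Channel C j → j ⇾ i → j ⇾ k → i ≡ k
  channel-unique ((_ , _ , only-v) , _) a b =
    node-injective (trans (only-v _ a) (sym (only-v _ b)))

  no-path-to-generator : ∀ {v i p} → ¬ TransClosure (Arc C) v (gen i p)
  no-path-to-generator (_ ∷ t) = no-path-to-generator t

  step-ctrl : ∀ {x u i} → ctrl C i ≡ true → step C x u i ≡ u i
  step-ctrl = if-cong

  step-conj : ∀ {x u i} → ctrl C i ≡ false →
    step C x u i ≡ and (map (λ j → not (eps C j i) ∨ x j) (allFin n))
  step-conj = if-cong

  step-kill : ∀ {x u i j} → j ⇾ i → x j ≡ false → step C x u i ≡ false
  step-kill {x} {u} {i} {j} (dep ci e) xj = trans (step-conj {x} {u} ci)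
    (and-map-false _ (allFin n) (∈-allFin j) (cong₂ (λ ε y → not ε ∨ y) e xj))

  step-pass : ∀ {x u i} → ctrl C i ≡ false → (∀ j → j ⇾ i → x j ≡ true) →
    step C x u i ≡ true
  step-pass {x} {u} {i} ci on = trans (step-conj {x} {u} ci) (and-map-true _ (allFin n) factor-on)
    where
    factor-on : ∀ j → not (eps C j i) ∨ x j ≡ true
    factor-on j with eps C j i in e
    ... | false = refl
    ... | true  = on j (dep ci e)

  step-kill⁻ : ∀ {x u i} → ctrl C i ≡ false → step C x u i ≡ false →
    ∃ λ j → j ⇾ i × x j ≡ false
  step-kill⁻ {x} {u} {i} ci off
    with j , fj ← and-map-false⁻ _ (allFin n) (trans (sym (step-conj {x} {u} ci)) off)
    with e , xj ← factor-false⁻ (eps C j i) (x j) fj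
    = j , dep ci e , xj

  -- Runs depend on the initial state only pointwise; there is no function extensionality.
  step-cong : ∀ {x y} → x ≗ y → ∀ u → step C x u ≗ step C y u
  step-cong x≗y u i = cong (λ z → if ctrl C i then u i else z)
    (cong and (map-cong (λ j → cong (not (eps C j i) ∨_) (x≗y j)) (allFin n)))

  run-cong : ∀ {x y} → x ≗ y → ∀ us m → run C x us m ≗ run C y us m
  run-cong x≗y us zero    = x≗y
  run-cong x≗y us (suc m) = step-cong (run-cong x≗y us m) (us m)

  run-prepend : ∀ x u us m → run C x (u ◂ us) (suc m) ≗ run C (step C x u) us m
  run-prepend x u us zero    i = refl
  run-prepend x u us (suc m) = step-cong (run-prepend x u us m) (us m)

  separated-uncontrolled : ∀ {x y u i} → step C x u i ≡ false → step C y u i ≡ true →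
    ctrl C i ≡ false
  separated-uncontrolled {i = i} off on with ctrl C i
  ... | true  = ⊥-elim (true≢false (trans (sym on) off))
  ... | false = refl

  step-separate : ∀ {x y u i} → step C x u i ≡ false → step C y u i ≡ true →
    ∃ λ j → j ⇾ i × x j ≢ y j
  step-separate {x} {y} {u} off on
    with j , a , xj ← step-kill⁻ {x} {u} (separated-uncontrolled {x} {y} {u} off on) off =
    j , a , λ xy → true≢false (trans (sym on) (step-kill {y} {u} a (trans (sym xy) xj)))

  step-diverge : ∀ {x y u i} → step C x u i ≢ step C y u i → ∃ λ j → j ⇾ i × x j ≢ y j
  step-diverge {x} {y} {u} {i} d with step C x u i in sx | step C y u i in sy
  ... | false | false = ⊥-elim (d refl)
  ... | true  | true  = ⊥-elim (d refl)
  ... | false | true  = step-separate {x} {y} {u} sx sy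
  ... | true  | false with j , a , yx ← step-separate {y} {x} {u} sy sx = j , a , yx ∘ sym

  run-diverge : ∀ a a′ us m i → run C a us m i ≢ run C a′ us m i →
    ∃ λ f → f 0 ≡ i × BackWalk _⇾_ f m
  run-diverge a a′ us zero    i _ = (λ _ → i) , refl , λ _ ()
  run-diverge a a′ us (suc m) i d
    with j , arc , d′ ← step-diverge {run C a us m} {run C a′ us m} {us m} d
    with f , f0≡j , walk ← run-diverge a a′ us m j d′
    = i ◂ f , refl , extend
    where
    extend : BackWalk _⇾_ (i ◂ f) (suc m)
    extend zero    _         = subst (_⇾ i) (sym f0≡j) arc
    extend (suc t) (s≤s t<m) = walk t t<m

  forget : IsDAG C → ∀ a a′ us → run C a us n ≗ run C a′ us n
  forget dag a a′ us i with run C a us n i ≟ᵇ run C a′ us n i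
  ... | yes same = same
  ... | no differ
    with _ , _ , walk ← run-diverge a a′ us n i differ
    with v , cycle ← walk-cycle walk
    = ⊥-elim (dag (node v) (lift-path cycle))

  vertexIndex : Vertex C → Fin n
  vertexIndex (node j)  = j
  vertexIndex (gen i _) = i

  module Preimage (P : PropertyP C) where

    parent : Fin n → Fin n
    parent i = vertexIndex (proj₁ (P i))

    parent-channel : ∀ {i} → ctrl C i ≡ false → parent i ⇾ i × Channel C (parent i)
    parent-channel {i} ci with P i
    ... | node j , dep _ e , inj₂ channel = dep ci e , channel
    ... | gen _ _ , ctl p , _ = ⊥-elim (true≢false (trans (sym p) ci))

    -- j must be off one step before b: it is the chosen parent of an uncontrolled
    -- node that b switches off.
    Silences : State n → Fin n → Fin n → Set
    Silences b j i = ctrl C i ≡ false × b i ≡ false × parent i ≡ j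

    silences? : ∀ b j i → Dec (Silences b j i)
    silences? b j i = (ctrl C i ≟ᵇ false) ×-dec (b i ≟ᵇ false) ×-dec (parent i ≟ j)

    preimage : State n → State n
    preimage b j = not (does (any? (silences? b j)))

    silences-only-child : ∀ {b i j} → j ⇾ i → b i ≡ true → ¬ ∃ (Silences b j)
    silences-only-child arc bi (i′ , ci′ , bi′ , refl)
      with arc′ , channel ← parent-channel ci′ =
      true≢false (trans (sym bi) (trans (cong _ (channel-unique channel arc arc′)) bi′))

    -- Controlled nodes take their value from the control b; an uncontrolled node off in b
    -- is killed by its parent; one on in b has only in-neighbours that silence nothing.
    preimage-step : ∀ b → step C (preimage b) b ≗ b
    preimage-step b i with ctrl C i ≟ᵇ false | b i ≟ᵇ false
    ... | no ci  | _      = step-ctrl {preimage b} {b} (¬-not ci)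
    ... | yes ci | yes bi = trans
      (step-kill {preimage b} {b} (proj₁ (parent-channel ci))
        (cong not (dec-true (any? (silences? b _)) (i , ci , bi , refl))))
      (sym bi)
    ... | yes ci | no bi  = trans
      (step-pass {preimage b} {b} ci λ j arc →
        cong not (dec-false (any? (silences? b j)) (silences-only-child arc (¬-not bi))))
      (sym (¬-not bi))

    reachable-at : ∀ m b → ∃ λ s → ∃ λ us → run C s us m ≗ b
    reachable-at zero    b = b , (λ _ → b) , λ _ → refl
    reachable-at (suc m) b with s , us , hits ← reachable-at m b =
      preimage s , s ◂ us , λ i → begin
        run C (preimage s) (s ◂ us) (suc m) i   ≡⟨ run-prepend (preimage s) s us m i ⟩
        run C (step C (preimage s) s) us m i    ≡⟨ run-cong (preimage-step s) us m i ⟩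
        run C s us m i                          ≡⟨ hits i ⟩
        b i                                     ∎
      where open ≡-Reasoning

  -- Sufficiency: some run reaches b at time n, and since the network forgets its
  -- initial state, the same controls reach b at time n from any state.
  sufficiency : IsDAG C → PropertyP C → Controllable C
  sufficiency dag P a b with s , us , hits ← Preimage.reachable-at P n b =
    n , us , λ i → trans (forget dag a s us i) (hits i)

  Cyclic : Fin n → Set
  Cyclic x = TransClosure (Arc C) (node x) (node x)

  cyclic-parent : ∀ {x} → Cyclic x → ∃ λ y → y ⇾ x × Cyclic y
  cyclic-parent {x} cycle with unsnoc cycle
  ... | inj₁ loop                      = x , loop , cycle
  ... | inj₂ (node y , path , arc)     = y , arc , arc ∷ path
  ... | inj₂ (gen _ _ , path , ctl _) = ⊥-elim (no-path-to-generator path)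

  cyclic-stays-off : ∀ us k {x} → Cyclic x → run C (λ _ → false) us k x ≡ false
  cyclic-stays-off us zero    _     = refl
  cyclic-stays-off us (suc k) cycle with y , arc , cycle′ ← cyclic-parent cycle =
    step-kill {run C (λ _ → false) us k} {us k} arc (cyclic-stays-off us k cycle′)

  -- Necessity of acyclicity: the all-one state is unreachable from the all-zero state
  -- if some node is cyclic, and generators have no incoming arcs at all.
  controllable⇒acyclic : Controllable C → IsDAG C
  controllable⇒acyclic ctrb (node x) cycle with N , us , hits ← ctrb (λ _ → false) (λ _ → true) =
    true≢false (trans (sym (hits x)) (cyclic-stays-off us N cycle))
  controllable⇒acyclic ctrb (gen _ _) path = no-path-to-generator path

  -- The state that is off exactly at i (the paper's target for proving Property P).
  offOnlyAt : Fin n → State n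
  offOnlyAt i k = not (does (k ≟ i))

  offOnlyAt-self : ∀ i → offOnlyAt i i ≡ false
  offOnlyAt-self i = cong not (dec-true (i ≟ i) refl)

  offOnlyAt-off⁻ : ∀ {i k} → offOnlyAt i k ≡ false → k ≡ i
  offOnlyAt-off⁻ {i} {k} off with k ≟ i
  ... | yes k≡i = k≡i

  -- Steer the all-one state to offOnlyAt i: at the last step some in-neighbour j of i
  -- is off, and any other out-neighbour of j would be switched off as well.
  channel-parent : IsDAG C → Controllable C → ∀ {i} → ctrl C i ≡ false →
    ∃ λ j → j ⇾ i × Channel C j
  channel-parent dag ctrb {i} ci with ctrb (λ _ → true) (offOnlyAt i)
  ... | zero  , us , hits = ⊥-elim (true≢false (trans (hits i) (offOnlyAt-self i)))
  ... | suc N , us , hits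
    with j , arc , xj ← step-kill⁻ {run C (λ _ → true) us N} {us N} ci
                          (trans (hits i) (offOnlyAt-self i))
    = j , arc , (node i , arc , only-child) , λ loop → dag (node j) [ loop ]
    where
    only-child : ∀ w → Arc C (node j) w → w ≡ node i
    only-child (node k) arc′ = cong node (offOnlyAt-off⁻
      (trans (sym (hits k)) (step-kill {run C (λ _ → true) us N} {us N} arc′ xj)))

  -- Necessity of Property P: generators serve controlled nodes, channels the others.
  controllable⇒propertyP : IsDAG C → Controllable C → PropertyP C
  controllable⇒propertyP dag ctrb i with ctrl C i ≟ᵇ false
  ... | no ci  = gen i (¬-not ci) , ctl (¬-not ci) , inj₁ tt
  ... | yes ci with j , arc , channel ← channel-parent dag ctrb ci = node j , arc , inj₂ channel

theorem2 : ∀ {n : ℕ} (C : CBCN n) → NoConstantUpdate C →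
    (Controllable C ⇔ (IsDAG C × PropertyP C))
theorem2 C _ = mk⇔
  (λ ctrb → let dag = controllable⇒acyclic C ctrb in dag , controllable⇒propertyP C dag ctrb)
  (λ (dag , P) → sufficiency C dag P)
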